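{- Let $\mathcal{F}\subseteq\binom{[n]}{r}$ be a family and let $\mathfrak{B}\mathcal{F}$ be its flower base of threshold $\alpha$, where $\alpha\ge r$ (and $\alpha\ge\tau(\mathcal{F})$). Then: (1) $\mathfrak{B}\mathcal{F}$ is Sperner, i.e., no member of $\mathfrak{B}\mathcal{F}$ contains another; (2) if $\mathcal{F}$ is intersecting, then $\mathfrak{B}\mathcal{F}$ is intersecting, and moreover each $B\in\mathfrak{B}\mathcal{F}$ is a transversal of $\mathcal{F}$; (3) $\tau(\mathfrak{B}\mathcal{F})=\tau(\mathcal{F})$.
   Context: A family is intersecting if every two members intersect. A transversal of a family $\mathcal{G}$ is a set of vertices meeting every member of $\mathcal{G}$; $\tau(\mathcal{G})$ is the minimum size of a transversal. For $\alpha\ge1$, a flower with threshold $\alpha$ and core $Y$ is a family $\mathcal{S}=\{S_1,\dots,S_m\}$ with $Y=\bigcap_{S\in\mathcal{S}}S$ such that the family of petals $\{S_1\setminus Y,\dots,S_m\setminus Y\}$ satisfies $\tau>\alpha$. For $\mathcal{F}\subseteq\binom{[n]}{r}$ and $\alpha\ge\tau(\mathcal{F})$, let $\mathcal{F}^*$ be the family of nonempty sets $Y\subset[n]$ that are cores of flowers of threshold $\alpha$ contained in $\mathcal{F}$; the flower base of threshold $\alpha$, $\mathfrak{B}\mathcal{F}$, is the family of inclusion-minimal members of $\mathcal{F}^*\cup\mathcal{F}$. -}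

module Defs where

open import Data.Nat using (ℕ; _≤_; _>_)
open import Data.Fin.Subset using (Subset; _∩_; _─_; _⊆_; ∣_∣; Nonempty; ⊤)
open import Data.List using (List; []; foldr)
open import Data.List.Membership.Propositional using () renaming (_∈_ to _∈ᴸ_)
open import Data.List.Relation.Unary.All using (All)
open import Data.Product using (Σ; ∃; _×_)
open import Data.Sum using (_⊎_)
open import Relation.Nullary using (¬_)
open import Relation.Binary.PropositionalEquality using (_≡_; _≢_)

Fam : ℕ → Set₁
Fam n = Subset n → Set

⟦_⟧ : ∀ {n} → List (Subset n) → Fam n
⟦ xs ⟧ A = A ∈ᴸ xs

Uniform : ∀ {n} → ℕ → Fam n → Set
Uniform r G = ∀ A → G A → ∣ A ∣ ≡ r

Intersecting : ∀ {n} → Fam n → Set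
Intersecting G = ∀ A B → G A → G B → Nonempty (A ∩ B)

Transversal : ∀ {n} → Subset n → Fam n → Set
Transversal T G = ∀ A → G A → Nonempty (T ∩ A)

IsTau : ∀ {n} → Fam n → ℕ → Set
IsTau G k = (Σ _ λ T → Transversal T G × ∣ T ∣ ≡ k)
          × (∀ T → Transversal T G → k ≤ ∣ T ∣)

-- τ(G) > α : no transversal has size ≤ α (includes the case τ = ∞)
TauAbove : ∀ {n} → ℕ → Fam n → Set
TauAbove α G = ∀ T → ∣ T ∣ ≤ α → ¬ Transversal T G

⋂ : ∀ {n} → List (Subset n) → Subset n
⋂ = foldr _∩_ ⊤

Petals : ∀ {n} → List (Subset n) → Subset n → Fam n
Petals 𝒮 Y Z = Σ _ λ S → S ∈ᴸ 𝒮 × Z ≡ (S ─ Y)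

IsFlower : ∀ {n} → ℕ → Fam n → List (Subset n) → Subset n → Set
IsFlower α F 𝒮 Y = 𝒮 ≢ [] × All F 𝒮 × Y ≡ ⋂ 𝒮 × TauAbove α (Petals 𝒮 Y)

Cores : ∀ {n} → ℕ → Fam n → Fam n
Cores α F Y = Nonempty Y × (Σ (List _) λ 𝒮 → IsFlower α F 𝒮 Y)

FlowerBase : ∀ {n} → ℕ → Fam n → Fam n
FlowerBase α F B = (Cores α F B ⊎ F B)
                 × (∀ Z → (Cores α F Z ⊎ F Z) → Z ⊆ B → Z ≡ B)

Sperner : ∀ {n} → Fam n → Set
Sperner G = ∀ A B → G A → G B → A ⊆ B → A ≡ B

{-# OPTIONS --safe #-}
module Submission where

-- A flower core Y meets every transversal X of F with |X| ≤ α, for otherwise X would be a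
-- transversal of size ≤ α of the petals. Every candidate (core or member of F) lies in a
-- member of F and so has size ≤ r ≤ α; when F is intersecting, its members, and then the
-- base members, are such small transversals. For τ: a minimum transversal of F has size
-- ≤ α, so it meets every candidate; conversely every member of F contains a base member
-- (⊂ is well-founded), so every transversal of the base is one of F.

open import Defs
open import Data.Nat using (ℕ; _≤_)
open import Data.Nat.Properties using (≤-trans; ≤-reflexive)
open import Data.Fin.Subset using (Subset; _∩_; _⊆_; _⊂_; _⊄_; ∣_∣; Nonempty)
open import Data.Fin.Subset.Properties
  using (nonempty?; _∈?_; ⊆-refl; ⊆-trans; ⊆-antisym; p⊆q⇒∣p∣≤∣q∣; p∩q⊆p; ∩-comm; x∈p∩q⁺; x∈p∩q⁻; x∈p∧x∉q⇒x∈p─q)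
open import Data.Fin.Subset.Induction using (⊂-wellFounded)
open import Data.List using (List; []; _∷_)
open import Data.List.Relation.Unary.All as All using (All; _∷_)
open import Data.Product using (_×_; _,_; ∃)
open import Data.Sum using (_⊎_; inj₁; inj₂)
open import Induction.WellFounded using (Acc; acc)
open import Relation.Nullary using (¬_; contradiction)
open import Relation.Nullary.Decidable using (decidable-stable)
open import Relation.Binary.PropositionalEquality using (_≡_; refl; sym; subst)

module _ {n : ℕ} where

  ∩-nonempty-comm : (p q : Subset n) → Nonempty (p ∩ q) → Nonempty (q ∩ p)
  ∩-nonempty-comm p q = subst Nonempty (∩-comm p q)

  ∩-nonempty-monoʳ : {p q r : Subset n} → q ⊆ r → Nonempty (p ∩ q) → Nonempty (p ∩ r)
  ∩-nonempty-monoʳ {p} {q} q⊆r (x , x∈p∩q) with x∈p∩q⁻ p q x∈p∩q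
  ... | x∈p , x∈q = x , x∈p∩q⁺ (x∈p , q⊆r x∈q)

  ⊆∧⊄⇒≡ : {p q : Subset n} → p ⊆ q → p ⊄ q → p ≡ q
  ⊆∧⊄⇒≡ {p} p⊆q p⊄q =
    ⊆-antisym p⊆q (λ {x} x∈q → decidable-stable (x ∈? p) (λ x∉p → p⊄q (p⊆q , x , x∈q , x∉p)))

module _ {n : ℕ} (P : Fam n) where

  Minimal : Fam n
  Minimal B = P B × (∀ Z → P Z → Z ⊆ B → Z ≡ B)

  minimal-sperner : Sperner Minimal
  minimal-sperner A B (pA , _) (_ , B-min) = B-min A pA

  -- Candidates are not decidable, so only ¬¬-existence is available; A is offered as the
  -- witness, and a strictly smaller candidate would make the recursive call refute no-min.
  minimal-⊆-acc : ∀ {A} → Acc _⊂_ A → P A → ¬ ¬ (∃ λ B → B ⊆ A × Minimal B)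
  minimal-⊆-acc {A} (acc rec) pA no-min = no-min (A , ⊆-refl , pA , A-min)
    where
    A-min : ∀ Z → P Z → Z ⊆ A → Z ≡ A
    A-min Z pZ Z⊆A = ⊆∧⊄⇒≡ Z⊆A λ Z⊂A →
      minimal-⊆-acc (rec Z⊂A) pZ λ { (B , B⊆Z , B-min) → no-min (B , ⊆-trans B⊆Z Z⊆A , B-min) }

  minimal-⊆ : ∀ {A} → P A → ¬ ¬ (∃ λ B → B ⊆ A × Minimal B)
  minimal-⊆ = minimal-⊆-acc (⊂-wellFounded _)

  minimal-transversal⇒transversal : ∀ {T} → Transversal T Minimal → Transversal T P
  minimal-transversal⇒transversal {T} T-tr A pA =
    decidable-stable (nonempty? (T ∩ A)) λ T∩A-empty →
      minimal-⊆ pA λ { (B , B⊆A , B-min) → T∩A-empty (∩-nonempty-monoʳ B⊆A (T-tr B B-min)) }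

module _ {n : ℕ} (α : ℕ) (G : Fam n) where

  Candidates : Fam n
  Candidates Z = Cores α G Z ⊎ G Z

  core⊆member : ∀ {Y} → Cores α G Y → ∃ λ S → G S × Y ⊆ S
  core⊆member (_ , [] , []≢[] , _) = contradiction refl []≢[]
  core⊆member (_ , S ∷ 𝒮 , _ , S∈G ∷ _ , refl , _) = S , S∈G , p∩q⊆p S _

  candidate-size : ∀ {r B} → Uniform r G → Candidates B → ∣ B ∣ ≤ r
  candidate-size uniform (inj₂ B∈G) = ≤-reflexive (uniform _ B∈G)
  candidate-size uniform (inj₁ core) with core⊆member core
  ... | S , S∈G , B⊆S = ≤-trans (p⊆q⇒∣p∣≤∣q∣ B⊆S) (≤-reflexive (uniform S S∈G))

  petals-transversal : ∀ {X Y 𝒮} → All G 𝒮 → Transversal X G → ¬ Nonempty (X ∩ Y)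
                     → Transversal X (Petals 𝒮 Y)
  petals-transversal {X} {Y} 𝒮⊆G X-tr X∩Y-empty _ (S , S∈𝒮 , refl)
    with X-tr S (All.lookup 𝒮⊆G S∈𝒮)
  ... | x , x∈X∩S with x∈p∩q⁻ X S x∈X∩S
  ... | x∈X , x∈S =
    x , x∈p∩q⁺ (x∈X , x∈p∧x∉q⇒x∈p─q x∈S (λ x∈Y → X∩Y-empty (x , x∈p∩q⁺ (x∈X , x∈Y))))

  core-meets-small-transversal : ∀ {X Y} → Cores α G Y → ∣ X ∣ ≤ α → Transversal X G
                               → Nonempty (X ∩ Y)
  core-meets-small-transversal {X} {Y} (_ , _ , _ , 𝒮⊆G , _ , petals-τ>α) ∣X∣≤α X-tr =
    decidable-stable (nonempty? (X ∩ Y)) λ X∩Y-empty →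
      petals-τ>α X ∣X∣≤α (petals-transversal 𝒮⊆G X-tr X∩Y-empty)

  small-transversal⇒candidates-transversal : ∀ {X} → ∣ X ∣ ≤ α → Transversal X G
                                           → Transversal X Candidates
  small-transversal⇒candidates-transversal ∣X∣≤α X-tr Y (inj₁ core) =
    core-meets-small-transversal core ∣X∣≤α X-tr
  small-transversal⇒candidates-transversal ∣X∣≤α X-tr Y (inj₂ Y∈G) = X-tr Y Y∈G

lemma2 : (n r α : ℕ) (F : List (Subset n)) → Uniform r ⟦ F ⟧ → r ≤ α
       → (t : ℕ) → IsTau ⟦ F ⟧ t → t ≤ α
       → Sperner (FlowerBase α ⟦ F ⟧)
         × (Intersecting ⟦ F ⟧
            → Intersecting (FlowerBase α ⟦ F ⟧)
              × (∀ B → FlowerBase α ⟦ F ⟧ B → Transversal B ⟦ F ⟧))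
         × IsTau (FlowerBase α ⟦ F ⟧) t
lemma2 n r α F uniform r≤α t ((T , T-tr , ∣T∣≡t) , τ-min) t≤α =
  minimal-sperner (Candidates α ⟦ F ⟧) , intersecting , (T , T-base-tr , ∣T∣≡t) , τ-base-min
  where
  small : ∀ {B} → Candidates α ⟦ F ⟧ B → ∣ B ∣ ≤ α
  small c = ≤-trans (candidate-size α ⟦ F ⟧ uniform c) r≤α

  meets-candidates : ∀ {X} → ∣ X ∣ ≤ α → Transversal X ⟦ F ⟧ → Transversal X (Candidates α ⟦ F ⟧)
  meets-candidates = small-transversal⇒candidates-transversal α ⟦ F ⟧

  intersecting : Intersecting ⟦ F ⟧ → Intersecting (FlowerBase α ⟦ F ⟧)
                 × (∀ B → FlowerBase α ⟦ F ⟧ B → Transversal B ⟦ F ⟧)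
  intersecting F-int = base-int , base-tr
    where
    base-tr : ∀ B → FlowerBase α ⟦ F ⟧ B → Transversal B ⟦ F ⟧
    base-tr B (cB , _) A A∈F =
      ∩-nonempty-comm A B (meets-candidates (small (inj₂ A∈F)) (λ C → F-int A C A∈F) B cB)

    base-int : Intersecting (FlowerBase α ⟦ F ⟧)
    base-int B₁ B₂ (c₁ , _) b₂@(c₂ , _) =
      ∩-nonempty-comm B₂ B₁ (meets-candidates (small c₂) (base-tr B₂ b₂) B₁ c₁)

  T-base-tr : Transversal T (FlowerBase α ⟦ F ⟧)
  T-base-tr B (cB , _) = meets-candidates (subst (_≤ α) (sym ∣T∣≡t) t≤α) T-tr B cB

  τ-base-min : ∀ X → Transversal X (FlowerBase α ⟦ F ⟧) → t ≤ ∣ X ∣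
  τ-base-min X X-tr =
    τ-min X λ A A∈F → minimal-transversal⇒transversal (Candidates α ⟦ F ⟧) X-tr A (inj₂ A∈F)
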